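{- Let $m$ be any fixed positive integer. Then every positive integer $x$ can be expressed in the form \[ x=\sum_{i=0}^{n-1} d_i G_i \] for some positive integer $n$ and integers $d_0,\dots,d_{n-1}$ satisfying $0 \leq d_i \leq m(i+1)-1$ for all $0\le i\le n-1$, where $G_i=m^{i}\, i!$. -}

module Defs where

open import Data.Nat using (ℕ; zero; suc; _+_; _*_; _^_; _!)
open import Data.Fin using (Fin; toℕ) renaming (zero to fzero; suc to fsuc)
open import Data.Vec using (Vec; lookup)

G : ℕ → ℕ → ℕ
G m i = m ^ i * i !

sumFin : (n : ℕ) → (Fin n → ℕ) → ℕ
sumFin zero    f = 0
sumFin (suc n) f = f fzero + sumFin n (λ i → f (fsuc i))

value : (m : ℕ) → {n : ℕ} → Vec ℕ n → ℕ
value m {n} d = sumFin n (λ i → lookup d i * G m (toℕ i))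

-- Since G (k + 1) = m (k + 1) G k, the G k are the place values of the mixed-radix
-- system with radices m, 2m, 3m, …, and the digits of x arise by repeated division:
-- x = r₀ + q₀ m, then q₀ G 1 = r₁ G 1 + q₁ G 2 with q₀ = r₁ + q₁ (2m), and so on.
-- Every radix but the first is at least 2, so the quotients strictly decrease once
-- the first step, whose radix m may be 1, is taken separately.
module Submission where

open import Defs
open import Data.Nat using (ℕ; zero; suc; _*_; _≤_; _∸_; _<_; _+_; _^_; _!; pred; z≤n; s≤s; NonZero; >-nonZero; _/_; _%_)
open import Data.Nat.Properties
open import Data.Nat.DivMod using (m≡m%n+[m/n]*n; m%n<n; m/n<m)
open import Data.Nat.Induction using (<-wellFounded)
open import Induction.WellFounded using (Acc; acc)
open import Data.Nat.Solver using (module +-*-Solver)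
open import Data.Fin using (Fin; toℕ) renaming (zero to fzero; suc to fsuc)
open import Data.Vec using (Vec; lookup; []; _∷_)
open import Data.Product using (Σ; _×_; _,_; proj₁; proj₂)
open import Relation.Binary.PropositionalEquality

Expansion : (m k N : ℕ) → Set
Expansion m k N = Σ ℕ λ n → Σ (Vec ℕ n) λ d →
  ((i : Fin n) → lookup d i < m * suc (k + toℕ i)) ×
  N ≡ sumFin n (λ i → lookup d i * G m (k + toℕ i))

sumFin-cong : ∀ n {f g : Fin n → ℕ} → (∀ i → f i ≡ g i) → sumFin n f ≡ sumFin n g
sumFin-cong zero    f≗g = refl
sumFin-cong (suc n) f≗g = cong₂ _+_ (f≗g fzero) (sumFin-cong n (λ i → f≗g (fsuc i)))

G-suc : ∀ m k → G m (suc k) ≡ m * suc k * G m k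
G-suc m k = solve 4 (λ m p f k → (m :* p) :* (f :+ k :* f) := (m :* (con 1 :+ k)) :* (p :* f))
  refl m (m ^ k) (k !) k
  where open +-*-Solver

expansion-cons : ∀ m k {N} r → r < m * suc k → Expansion m (suc k) N →
                 Expansion m k (r * G m k + N)
expansion-cons m k {N} r r<b (n , d , d<b , N≡) = suc n , r ∷ d , bounds , value≡
  where
  bounds : (i : Fin (suc n)) → lookup (r ∷ d) i < m * suc (k + toℕ i)
  bounds fzero    = subst (λ j → r < m * suc j) (sym (+-identityʳ k)) r<b
  bounds (fsuc i) = subst (λ j → lookup d i < m * suc j) (sym (+-suc k (toℕ i))) (d<b i)

  value≡ : r * G m k + N ≡ r * G m (k + 0) + sumFin n (λ i → lookup d i * G m (k + suc (toℕ i)))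
  value≡ = cong₂ _+_ (cong (λ j → r * G m j) (sym (+-identityʳ k)))
    (trans N≡ (sumFin-cong n (λ i → cong (λ j → lookup d i * G m j) (sym (+-suc k (toℕ i))))))

multiple-expansion : ∀ m k → 1 ≤ m → 1 ≤ k → ∀ y → Acc _<_ y → Expansion m k (y * G m k)
multiple-expansion m k 1≤m 1≤k zero    _        = 0 , [] , (λ ()) , refl
multiple-expansion m k 1≤m 1≤k (suc y) (acc rs) =
  subst (Expansion m k) (sym split) (expansion-cons m k r (m%n<n (suc y) b) rest)
  where
  b = m * suc k
  2≤b : 2 ≤ b
  2≤b = ≤-trans (s≤s 1≤k) (≤-trans (≤-reflexive (sym (*-identityˡ (suc k)))) (*-monoˡ-≤ (suc k) 1≤m))
  instance
    b≢0 : NonZero b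
    b≢0 = >-nonZero (≤-trans (s≤s z≤n) 2≤b)
  q = suc y / b
  r = suc y % b

  rest : Expansion m (suc k) (q * G m (suc k))
  rest = multiple-expansion m (suc k) 1≤m (s≤s z≤n) q (rs (m/n<m (suc y) b 2≤b))

  split : suc y * G m k ≡ r * G m k + q * G m (suc k)
  split = begin
    suc y * G m k               ≡⟨ cong (_* G m k) (m≡m%n+[m/n]*n (suc y) b) ⟩
    (r + q * b) * G m k         ≡⟨ *-distribʳ-+ (G m k) r (q * b) ⟩
    r * G m k + q * b * G m k   ≡⟨ cong (r * G m k +_) (*-assoc q b (G m k)) ⟩
    r * G m k + q * (b * G m k) ≡⟨ cong (λ g → r * G m k + q * g) (sym (G-suc m k)) ⟩
    r * G m k + q * G m (suc k) ∎
    where open ≡-Reasoning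

theorem2p1 : (m : ℕ) → 1 ≤ m → (x : ℕ) → 1 ≤ x →
    Σ ℕ (λ n → 1 ≤ n × Σ (Vec ℕ n) (λ d →
      ((i : Fin n) → lookup d i ≤ m * (toℕ i + 1) ∸ 1) × x ≡ value m d))
theorem2p1 m 1≤m x _ = n , s≤s z≤n , d , digit-bounds , trans x≡ value≡
  where
  instance
    m≢0 : NonZero m
    m≢0 = >-nonZero 1≤m
  q = x / m
  r = x % m

  x≡ : x ≡ r * G m 0 + q * G m 1
  x≡ = trans (m≡m%n+[m/n]*n x m)
    (cong₂ _+_ (sym (*-identityʳ r)) (cong (q *_) (sym (trans (*-identityʳ (m * 1)) (*-identityʳ m)))))

  expansion : Expansion m 0 (r * G m 0 + q * G m 1)
  expansion = expansion-cons m 0 r (subst (r <_) (sym (*-identityʳ m)) (m%n<n x m))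
    (multiple-expansion m 1 1≤m ≤-refl q (<-wellFounded q))

  -- n reduces to suc _, as expansion-cons always prepends a digit.
  n : ℕ
  n = proj₁ expansion

  d : Vec ℕ n
  d = proj₁ (proj₂ expansion)

  value≡ : r * G m 0 + q * G m 1 ≡ value m d
  value≡ = proj₂ (proj₂ (proj₂ expansion))

  digit-bounds : (i : Fin n) → lookup d i ≤ m * (toℕ i + 1) ∸ 1
  digit-bounds i = subst (lookup d i ≤_) (cong pred (cong (m *_) (+-comm 1 (toℕ i))))
    (<⇒≤pred (proj₁ (proj₂ (proj₂ expansion)) i))
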